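{- For every integer $n\ge 2$, let $H_1(n):=1+\sum_{i=1}^{n-1}\frac{(n+i-2)!}{i!}\,i$. Then $n$ is prime if and only if $n\mid H_1(n)$. -}

module Defs where

open import Data.Nat using (ℕ; zero; suc; _+_; _*_; _∸_; _/_; _!)
open import Data.Nat.Properties using (_!≢0)

sumFrom1 : ℕ → (ℕ → ℕ) → ℕ
sumFrom1 zero    f = 0
sumFrom1 (suc m) f = sumFrom1 m f + f (suc m)

-- term i = ((n + i - 2)! / i!) * i ; for n ≥ 2 and i ≥ 1 the division is exact
-- since i ≤ n + i - 2, so i! ∣ (n + i - 2)!.
H₁term : ℕ → ℕ → ℕ
H₁term n i = ((((n + i) ∸ 2) !) / (i !)) {{i !≢0}} * i

H₁ : ℕ → ℕ
H₁ n = 1 + sumFrom1 (n ∸ 1) (H₁term n)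

module Submission where

-- The criterion reduces to Wilson's theorem.  The summand for i = 1 is
-- (n-1)!, and for 2 ≤ i ≤ n-1 the quotient (n+i-2)!/i! = (i+1)(i+2)⋯(n+i-2)
-- is a product of consecutive integers containing n, so H₁(n) ≡ 1 + (n-1)!
-- (mod n).  Hence the theorem is equivalent to Wilson's theorem and its
-- converse: n ∣ 1 + (n-1)! iff n is prime.

open import Defs
open import Data.Nat using (ℕ; _≥_)
open import Data.Nat.Divisibility using (_∣_)
open import Data.Nat.Primality using (Prime)
open import Function.Bundles using (_⇔_)

open import Data.Nat.Base
  using ( zero; suc; _+_; _*_; _∸_; _%_; _/_; _!; _≤_; _<_; z≤n; s≤s
        ; NonZero; NonTrivial; nonTrivial⇒nonZero; nonTrivial⇒≢1 )
open import Data.Nat.Properties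
open import Data.Nat.DivMod
open import Data.Nat.Divisibility
open import Data.Nat.Primality
open import Data.Nat.Coprimality using (Coprime; coprime-Bézout; prime⇒coprime)
import Data.Nat.Coprimality as Coprimality
open import Data.Nat.GCD using (module Bézout)
open import Data.Nat.Tactic.RingSolver using (solve-∀)
open import Data.Nat.ListAction using (product)
open import Data.Nat.ListAction.Properties using (product-↭)
open import Data.List.Base using (List; []; _∷_; _++_; length; applyDownFrom)
open import Data.List.Membership.Propositional using (_∈_; _∉_)
open import Data.List.Membership.Propositional.Properties
  using (∈-∃++; ∈-applyDownFrom⁺; ∈-applyDownFrom⁻)
open import Data.List.Relation.Unary.Any using (here; there)
open import Data.List.Relation.Unary.All as All using (All)
import Data.List.Relation.Unary.AllPairs as AllPairs
open import Data.List.Relation.Unary.Unique.Propositional using (Unique)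
open import Data.List.Relation.Unary.Unique.Propositional.Properties
  using (applyDownFrom⁺₁; Unique[x∷xs]⇒x∉xs)
open import Data.List.Relation.Binary.Permutation.Propositional
  using (_↭_; prep; ↭-sym; ↭⇒↭ₛ)
open import Data.List.Relation.Binary.Permutation.Propositional.Properties
  using (All-resp-↭; ∈-resp-↭; ↭-length; shift)
open import Relation.Binary.PropositionalEquality
open import Data.List.Relation.Binary.Permutation.Setoid.Properties (setoid ℕ)
  using (Unique-resp-↭)
open import Data.Product using (∃-syntax; ∃₂; _×_; _,_)
open import Data.Sum using (_⊎_; inj₁; inj₂)
open import Relation.Nullary using (¬_; yes; no; contradiction)
open import Function.Bundles using (mk⇔)

module Modulo (m : ℕ) .{{_ : NonZero m}} where

  infix 4 _≋_
  _≋_ : ℕ → ℕ → Set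
  a ≋ b = a % m ≡ b % m

  +-cong : ∀ {a a′ b b′} → a ≋ a′ → b ≋ b′ → a + b ≋ a′ + b′
  +-cong {a} {a′} {b} {b′} a≋a′ b≋b′ = begin
    (a + b) % m             ≡⟨ %-distribˡ-+ a b m ⟩
    (a % m + b % m) % m     ≡⟨ cong₂ (λ x y → (x + y) % m) a≋a′ b≋b′ ⟩
    (a′ % m + b′ % m) % m   ≡⟨ %-distribˡ-+ a′ b′ m ⟨
    (a′ + b′) % m           ∎
    where open ≡-Reasoning

  *-cong : ∀ {a a′ b b′} → a ≋ a′ → b ≋ b′ → a * b ≋ a′ * b′
  *-cong {a} {a′} {b} {b′} a≋a′ b≋b′ = begin
    (a * b) % m               ≡⟨ %-distribˡ-* a b m ⟩
    ((a % m) * (b % m)) % m   ≡⟨ cong₂ (λ x y → (x * y) % m) a≋a′ b≋b′ ⟩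
    ((a′ % m) * (b′ % m)) % m ≡⟨ %-distribˡ-* a′ b′ m ⟨
    (a′ * b′) % m             ∎
    where open ≡-Reasoning

  residue-≡ : ∀ {a b} → a < m → b < m → a ≋ b → a ≡ b
  residue-≡ a<m b<m a≋b = trans (sym (m<n⇒m%n≡m a<m)) (trans a≋b (m<n⇒m%n≡m b<m))

  ∣-resp-≋ : ∀ {a b} → a ≋ b → m ∣ a → m ∣ b
  ∣-resp-≋ {a} {b} a≋b m∣a =
    m%n≡0⇒n∣m b m (trans (sym a≋b) (n∣m⇒m%n≡0 a m m∣a))

  -- A summand that does not change the class of y is a multiple of m:
  -- writing x + y = r + Q·m and y = r + q·m gives q·m + x = Q·m.
  ≋-cancel⇒∣ : ∀ x y → x + y ≋ y → m ∣ x
  ≋-cancel⇒∣ x y x+y≋y = ∣m+n∣m⇒∣n (subst (m ∣_) (sym q*m+x≡Q*m) (n∣m*n Q)) (n∣m*n q)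
    where
    Q = (x + y) / m
    q = y / m
    rearrange : ∀ a b c → (a + b) + c ≡ b + (c + a)
    rearrange = solve-∀
    q*m+x≡Q*m : q * m + x ≡ Q * m
    q*m+x≡Q*m = +-cancelʳ-≡ (y % m) (q * m + x) (Q * m) (begin
      (q * m + x) + y % m   ≡⟨ rearrange (q * m) x (y % m) ⟩
      x + (y % m + q * m)   ≡⟨ cong (x +_) (m≡m%n+[m/n]*n y m) ⟨
      x + y                 ≡⟨ m≡m%n+[m/n]*n (x + y) m ⟩
      (x + y) % m + Q * m   ≡⟨ cong (_+ Q * m) x+y≋y ⟩
      y % m + Q * m         ≡⟨ +-comm (y % m) (Q * m) ⟩
      Q * m + y % m         ∎)
      where open ≡-Reasoning

  inverse-unique : ∀ {a b c} → a * b ≋ 1 → a * c ≋ 1 → b ≋ c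
  inverse-unique {a} {b} {c} ab≋1 ac≋1 = begin
    b % m               ≡⟨ cong (_% m) (*-identityʳ b) ⟨
    (b * 1) % m         ≡⟨ *-cong {b} refl ac≋1 ⟨
    (b * (a * c)) % m   ≡⟨ cong (_% m) (reassociate a b c) ⟩
    ((a * b) * c) % m   ≡⟨ *-cong ab≋1 refl ⟩
    (1 * c) % m         ≡⟨ cong (_% m) (*-identityˡ c) ⟩
    c % m               ∎
    where
    open ≡-Reasoning
    reassociate : ∀ a b c → b * (a * c) ≡ (a * b) * c
    reassociate = solve-∀

  sum-≋-first : ∀ k f → (∀ j → j < k → m ∣ f (2 + j)) → sumFrom1 (suc k) f ≋ f 1
  sum-≋-first zero    f _   = refl
  sum-≋-first (suc k) f m∣f =
    trans (%-remove-+ʳ (sumFrom1 (suc k) f) (m∣f k (n<1+n k)))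
          (sum-≋-first k f (λ j j<k → m∣f j (m<n⇒m<1+n j<k)))

  record Paired (L : List ℕ) : Set where
    field
      distinct : Unique L
      residues : All (_< m) L
      partner  : ∀ {a} → a ∈ L → ∃[ b ] b ∈ L × b ≢ a × a * b ≋ 1

  split-pair : ∀ {a L} → Paired (a ∷ L) →
               ∃₂ λ b L′ → (a ∷ L ↭ a ∷ b ∷ L′) × a * b ≋ 1 × Paired L′
  split-pair {a} P with Paired.partner P (here refl)
  ... | b , here b≡a , b≢a , _ = contradiction b≡a b≢a
  ... | b , there b∈L , _ , ab≋1 with ∈-∃++ b∈L
  ...   | ys , zs , refl = b , ys ++ zs , σ , ab≋1 , record
    { distinct = AllPairs.tail (AllPairs.tail distinct′)
    ; residues = All.tail (All.tail residues′)
    ; partner  = partner′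
    }
    where
    open Paired P
    L′ = ys ++ zs
    σ : a ∷ ys ++ b ∷ zs ↭ a ∷ b ∷ L′
    σ = prep a (shift b ys zs)
    distinct′ : Unique (a ∷ b ∷ L′)
    distinct′ = Unique-resp-↭ (↭⇒↭ₛ σ) distinct
    residues′ : All (_< m) (a ∷ b ∷ L′)
    residues′ = All-resp-↭ σ residues
    a∉L′ : a ∉ L′
    a∉L′ a∈L′ = Unique[x∷xs]⇒x∉xs distinct′ (there a∈L′)
    b∉L′ : b ∉ L′
    b∉L′ = Unique[x∷xs]⇒x∉xs (AllPairs.tail distinct′)
    -- An element x of L′ inverse to u, where u has inverse v in a ∷ b ∷ L′,
    -- equals v; applied with {u, v} = {a, b} this shows x ∉ L′.
    inverse-in-pair : ∀ {x u v} → x ∈ L′ → v ∈ a ∷ b ∷ L′ → x * u ≋ 1 → u * v ≋ 1 → x ≡ v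
    inverse-in-pair {x} {u} x∈ v∈ xu≋1 uv≋1 =
      residue-≡ (All.lookup residues′ (there (there x∈))) (All.lookup residues′ v∈)
        (inverse-unique {u} (trans (cong (_% m) (*-comm u x)) xu≋1) uv≋1)
    partner′ : ∀ {x} → x ∈ L′ → ∃[ y ] y ∈ L′ × y ≢ x × x * y ≋ 1
    partner′ x∈L′ with partner (∈-resp-↭ (↭-sym σ) (there (there x∈L′)))
    ... | y , y∈L , y≢x , xy≋1 with ∈-resp-↭ σ y∈L
    ...   | here refl = contradiction (subst (_∈ L′) x≡b x∈L′) b∉L′
      where
      x≡b = inverse-in-pair x∈L′ (there (here refl)) xy≋1 ab≋1
    ...   | there (here refl) = contradiction (subst (_∈ L′) x≡a x∈L′) a∉L′
      where
      x≡a = inverse-in-pair x∈L′ (here refl) xy≋1 (trans (cong (_% m) (*-comm b a)) ab≋1)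
    ...   | there (there y∈L′) = y , y∈L′ , y≢x , xy≋1

  -- Pairing lemma: the product of a paired list is ≡ 1, since the elements
  -- cancel in pairs.  The recursion is on an upper bound for the length.
  paired-product : ∀ L → Paired L → product L ≋ 1
  paired-product L = bounded (length L) L ≤-refl
    where
    bounded : ∀ n L → length L ≤ n → Paired L → product L ≋ 1
    bounded _       []      _         _ = refl
    bounded (suc n) (a ∷ L) (s≤s |L|≤n) P with split-pair P
    ... | b , L′ , σ , ab≋1 , P′ = begin
      product (a ∷ L) % m          ≡⟨ cong (_% m) (product-↭ σ) ⟩
      (a * (b * product L′)) % m   ≡⟨ cong (_% m) (*-assoc a b (product L′)) ⟨
      ((a * b) * product L′) % m   ≡⟨ *-cong ab≋1 (bounded n L′ |L′|≤n P′) ⟩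
      1 % m                        ∎
      where
      open ≡-Reasoning
      |L′|≤n : length L′ ≤ n
      |L′|≤n = ≤-trans (n≤1+n (length L′))
                 (subst (_≤ n) (suc-injective (↭-length σ)) |L|≤n)

module _ (q : ℕ) where
  open Modulo (suc q)

  coprime⇒inverse : ∀ {a} → Coprime a (suc q) → ∃[ b ] a * b ≋ 1
  coprime⇒inverse {a} coprime with coprime-Bézout coprime
  ... | Bézout.+- x y 1+y*m≡x*a = x , (begin
    (a * x) % suc q           ≡⟨ cong (_% suc q) (*-comm a x) ⟩
    (x * a) % suc q           ≡⟨ cong (_% suc q) 1+y*m≡x*a ⟨
    (1 + y * suc q) % suc q   ≡⟨ [m+kn]%n≡m%n 1 y (suc q) ⟩
    1 % suc q                 ∎)
    where open ≡-Reasoning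
  -- Here x·a ≡ -1, so x·(m-1) = x·q is an inverse of a.
  ... | Bézout.-+ x y 1+x*a≡y*m = x * q , (begin
    (a * (x * q)) % suc q           ≡⟨ [m+n]%n≡m%n (a * (x * q)) (suc q) ⟨
    (a * (x * q) + suc q) % suc q   ≡⟨ cong (_% suc q) (rearrange a x q) ⟩
    (1 + (1 + x * a) * q) % suc q   ≡⟨ cong (λ z → (1 + z * q) % suc q) 1+x*a≡y*m ⟩
    (1 + y * suc q * q) % suc q     ≡⟨ %-remove-+ʳ 1 (n∣m*n*o y {suc q} q) ⟩
    1 % suc q                       ∎)
    where
    open ≡-Reasoning
    rearrange : ∀ a x q → a * (x * q) + suc q ≡ 1 + (1 + x * a) * q
    rearrange = solve-∀

from2to1+ : ℕ → List ℕ
from2to1+ = applyDownFrom (2 +_)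

product-from2to1+ : ∀ j → product (from2to1+ j) ≡ suc j !
product-from2to1+ zero    = refl
product-from2to1+ (suc j) = cong ((2 + j) *_) (product-from2to1+ j)

-- Wilson's theorem for a prime p = j + 3, by pairing each of 2, …, p-2
-- with its inverse.
module WilsonPairing (j : ℕ) (p-prime : Prime (3 + j)) where
  p : ℕ
  p = 3 + j

  open Modulo p

  -- p - 1 is its own inverse: (p-1)² = (p-2)·p + 1.
  p-1-self-inverse : (2 + j) * (2 + j) ≋ 1
  p-1-self-inverse = trans (cong (_% p) (square j)) (%-remove-+ˡ 1 (n∣m*n (1 + j) {p}))
    where
    square : ∀ j → (2 + j) * (2 + j) ≡ (1 + j) * (3 + j) + 1
    square = solve-∀

  -- The only self-inverse residues are 1 and p - 1, since a² ≡ 1 means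
  -- p ∣ (a-1)(a+1).
  self-inverse : ∀ {a} → 0 < a → a < p → a * a ≋ 1 → a ≡ 1 ⊎ a ≡ 2 + j
  self-inverse {suc c} _ a<p a²≋1 with euclidsLemma c (2 + c) p-prime p∣[a-1][a+1]
    where
    square : ∀ c → suc c * suc c ≡ c * (2 + c) + 1
    square = solve-∀
    p∣[a-1][a+1] : p ∣ c * (2 + c)
    p∣[a-1][a+1] = ≋-cancel⇒∣ (c * (2 + c)) 1 (trans (cong (_% p) (sym (square c))) a²≋1)
  ... | inj₁ p∣c = inj₁ (cong suc (multiple<⇒≡0 p∣c (<-trans (n<1+n c) a<p)))
    where
    multiple<⇒≡0 : ∀ {c} → p ∣ c → c < p → c ≡ 0
    multiple<⇒≡0 {zero}  _   _   = refl
    multiple<⇒≡0 {suc c} p∣c c<p = contradiction (∣⇒≤ p∣c) (<⇒≱ c<p)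
  ... | inj₂ p∣c+2 = inj₂ (suc-injective (≤-antisym a<p (∣⇒≤ p∣c+2)))

  inverse-of-self-inverse : ∀ {a b} → a < p → b < p → a * b ≋ 1 → b * b ≋ 1 → a ≡ b
  inverse-of-self-inverse {a} {b} a<p b<p ab≋1 b²≋1 =
    residue-≡ a<p b<p (inverse-unique {b} (trans (cong (_% p) (*-comm b a)) ab≋1) b²≋1)

  middle : List ℕ
  middle = from2to1+ j

  middle-< : ∀ {a} → a ∈ middle → a < p
  middle-< a∈ with ∈-applyDownFrom⁻ (2 +_) a∈
  ... | i , i<j , refl = s≤s (s≤s (m<n⇒m<1+n i<j))

  middle-¬self-inverse : ∀ {a} → a ∈ middle → ¬ (a * a ≋ 1)
  middle-¬self-inverse a∈ a²≋1 with ∈-applyDownFrom⁻ (2 +_) a∈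
  ... | i , i<j , refl with self-inverse (s≤s z≤n) (middle-< a∈) a²≋1
  ...   | inj₂ 2+i≡2+j = <⇒≢ i<j (suc-injective (suc-injective 2+i≡2+j))

  -- The inverse b of a ∈ middle is again in middle and differs from a:
  -- b = 0 is impossible, and b = 1 or b = p - 1 would force a = b.
  inverse-in-middle : ∀ {a b} → a ∈ middle → b < p → a * b ≋ 1 → b ∈ middle × b ≢ a
  inverse-in-middle {a} {b} a∈ b<p ab≋1 = b∈middle b b<p ab≋1 , b≢a
    where
    a<p = middle-< a∈
    b≢a : b ≢ a
    b≢a refl = middle-¬self-inverse a∈ ab≋1
    not-self-inverse : ∀ {b} → b < p → a * b ≋ 1 → ¬ (b * b ≋ 1)
    not-self-inverse b<p ab≋1 b²≋1 with inverse-of-self-inverse a<p b<p ab≋1 b²≋1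
    ... | refl = middle-¬self-inverse a∈ b²≋1
    b∈middle : ∀ b → b < p → a * b ≋ 1 → b ∈ middle
    b∈middle zero          _   ab≋1 with () ← trans (cong (_% p) (sym (*-zeroʳ a))) ab≋1
    b∈middle (suc zero)    b<p ab≋1 = contradiction refl (not-self-inverse b<p ab≋1)
    b∈middle (suc (suc i)) b<p ab≋1 with m≤n⇒m<n∨m≡n (≤-pred (≤-pred (≤-pred b<p)))
    ... | inj₁ i<j  = ∈-applyDownFrom⁺ (2 +_) i<j
    ... | inj₂ refl = contradiction p-1-self-inverse (not-self-inverse b<p ab≋1)

  middle-paired : Paired middle
  middle-paired = record
    { distinct = applyDownFrom⁺₁ (2 +_) j
                   (λ i<k _ 2+k≡2+i → <⇒≢ (s≤s (s≤s i<k)) (sym 2+k≡2+i))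
    ; residues = All.tabulate middle-<
    ; partner  = partner
    }
    where
    partner : ∀ {a} → a ∈ middle → ∃[ b ] b ∈ middle × b ≢ a × a * b ≋ 1
    -- a = 2 + i is visibly non-zero, as prime⇒coprime requires; the
    -- Bézout inverse b is then reduced modulo p.
    partner {a} a∈ with ∈-applyDownFrom⁻ (2 +_) a∈
    ... | i , _ , refl
      with coprime⇒inverse (2 + j) (Coprimality.sym (prime⇒coprime p-prime (middle-< a∈)))
    ...   | b , ab≋1 =
      let ab%p≋1 = trans (*-cong {a} {a} {b % p} {b} refl (m%n%n≡m%n b p)) ab≋1
          b%p∈ , b%p≢a = inverse-in-middle a∈ (m%n<n b p) ab%p≋1
      in b % p , b%p∈ , b%p≢a , ab%p≋1

  -- (p-1)! = (p-1)·(p-2)! ≡ (p-1)·1, so 1 + (p-1)! ≡ p ≡ 0.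
  wilson-pairing : p ∣ 1 + (2 + j) !
  wilson-pairing = ∣-resp-≋ (sym 1+[p-1]!≋p) p∣p
    where
    [p-2]!≋1 : suc j ! ≋ 1
    [p-2]!≋1 = subst (_≋ 1) (product-from2to1+ j) (paired-product middle middle-paired)
    1+[p-1]!≋p : 1 + (2 + j) ! ≋ 1 + (2 + j) * 1
    1+[p-1]!≋p = +-cong {1} {1} {(2 + j) !} {(2 + j) * 1} refl
                   (*-cong {2 + j} {2 + j} {suc j !} {1} refl [p-2]!≋1)
    p∣p : p ∣ 1 + (2 + j) * 1
    p∣p = subst (p ∣_) (cong (1 +_) (sym (*-identityʳ (2 + j)))) ∣-refl

wilson : ∀ {p} → Prime p → p ∣ 1 + (p ∸ 1) !
wilson {zero}              p-prime = contradiction p-prime ¬prime[0]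
wilson {suc zero}          p-prime = contradiction p-prime ¬prime[1]
wilson {suc (suc zero)}    _       = ∣-refl
wilson {suc (suc (suc j))} p-prime = WilsonPairing.wilson-pairing j p-prime

∣-factorial : ∀ {d n} .{{_ : NonZero d}} → d ≤ n → d ∣ n !
∣-factorial {suc e} d≤n = ∣-trans (m∣m*n (e !)) (m≤n⇒m!∣n! d≤n)

-- Converse of Wilson's theorem: a proper divisor d of n divides (n-1)!,
-- so if n ∣ 1 + (n-1)! then d ∣ 1.
wilson-converse : ∀ {n} .{{_ : NonTrivial n}} → n ∣ 1 + (n ∸ 1) ! → Prime n
wilson-converse {n} n∣1+[n-1]! = ¬composite⇒prime λ where
  (hasNonTrivialDivisor {divisor = d} d<n d∣n) →
    let d≤n-1 = subst (d ≤_) (pred[m∸n]≡m∸[1+n] n 0) (<⇒≤pred d<n)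
        d∣[n-1]! = ∣-factorial {{nonTrivial⇒nonZero d}} d≤n-1
        d∣[n-1]!+1 = subst (d ∣_) (+-comm 1 ((n ∸ 1) !)) (∣-trans d∣n n∣1+[n-1]!)
    in nonTrivial⇒≢1 {d} (∣1⇒≡1 (∣m+n∣m⇒∣n d∣[n-1]!+1 d∣[n-1]!))

rising : ℕ → ℕ → ℕ
rising i zero    = 1
rising i (suc m) = suc (m + i) * rising i m

!-split : ∀ i m → (m + i) ! ≡ rising i m * i !
!-split i zero    = sym (+-identityʳ (i !))
!-split i (suc m) = begin
  suc (m + i) * (m + i) !          ≡⟨ cong (suc (m + i) *_) (!-split i m) ⟩
  suc (m + i) * (rising i m * i !) ≡⟨ *-assoc (suc (m + i)) (rising i m) (i !) ⟨
  rising i (suc m) * i !           ∎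
  where open ≡-Reasoning

∣-rising : ∀ {t} i m → i < t → t ≤ m + i → t ∣ rising i m
∣-rising i zero    i<t t≤i = contradiction t≤i (<⇒≱ i<t)
∣-rising {t} i (suc m) i<t t≤1+m+i with t ≟ suc (m + i)
... | yes refl = m∣m*n (rising i m)
... | no t≢1+m+i =
  ∣n⇒∣m*n (suc (m + i)) (∣-rising i m i<t (≤-pred (≤∧≢⇒< t≤1+m+i t≢1+m+i)))

-- For n = k + 2 and 2 ≤ i ≤ n - 1 the summand (n+i-2)!/i! · i is a multiple
-- of n, because (k+i)!/i! = (i+1)⋯(i+k) and i < n ≤ k + i.
∣-H₁term : ∀ k j → j < k → 2 + k ∣ H₁term (2 + k) (2 + j)
∣-H₁term k j j<k = subst (2 + k ∣_) (sym term≡) (∣m⇒∣m*n i (∣-rising i k i<n n≤k+i))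
  where
  i = 2 + j
  i<n : i < 2 + k
  i<n = s≤s (s≤s j<k)
  n≤k+i : 2 + k ≤ k + i
  n≤k+i = subst (_≤ k + i) (+-comm k 2) (+-monoʳ-≤ k (m≤m+n 2 j))
  instance
    i!≢0 : NonZero (i !)
    i!≢0 = i !≢0
  term≡ : H₁term (2 + k) i ≡ rising i k * i
  term≡ = cong (_* i) (begin
    (k + i) ! / i !           ≡⟨ /-congˡ (!-split i k) ⟩
    rising i k * i ! / i !    ≡⟨ m*n/n≡m (rising i k) (i !) ⟩
    rising i k                ∎)
    where open ≡-Reasoning

H₁term-1 : ∀ k → H₁term (2 + k) 1 ≡ suc k !
H₁term-1 k = trans (*-identityʳ _) (trans (n/1≡n ((k + 1) !)) (cong _! (+-comm k 1)))

module _ (k : ℕ) where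
  open Modulo (2 + k)

  H₁-≋ : H₁ (2 + k) ≋ 1 + suc k !
  H₁-≋ = +-cong {1} {1} {sumFrom1 (suc k) (H₁term (2 + k))} {suc k !} refl
    (trans (sum-≋-first k (H₁term (2 + k)) (∣-H₁term k)) (cong (_% (2 + k)) (H₁term-1 k)))

-- n is prime iff n ∣ 1 + (n-1)! (Wilson and its converse), and
-- n ∣ 1 + (n-1)! iff n ∣ H₁(n) since the two are congruent modulo n.
mainTheorem4 : (n : ℕ) → n ≥ 2 → (Prime n ⇔ n ∣ H₁ n)
mainTheorem4 (suc (suc k)) (s≤s (s≤s _)) = mk⇔
  (λ n-prime → ∣-resp-≋ (sym (H₁-≋ k)) (wilson n-prime))
  (λ n∣H₁ → wilson-converse (∣-resp-≋ (H₁-≋ k) n∣H₁))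
  where open Modulo (2 + k)
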